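{- Let $n\ge 3$ be an integer, ${\mathrm T}_m=\binom{m+1}{2}$, and ${\mathcal T}_n=\langle {\mathrm T}_n,{\mathrm T}_{n+1},{\mathrm T}_{n+2}\rangle$. Then ${\mathcal T}_n$ is a free numerical semigroup with embedding dimension equal to three.
   Context: $\langle a_1,\ldots,a_k\rangle$ denotes the set of non-negative integer linear combinations of $a_1,\ldots,a_k$. A numerical semigroup is a submonoid of $(\mathbb N,+)$ with finite complement in $\mathbb N$; it has a unique minimal system of generators, whose cardinality is its embedding dimension. A sequence $(a_1,\ldots,a_k)$ of positive integers with $\gcd=1$ is telescopic if, with $d_i=\gcd\{a_1,\ldots,a_i\}$, each $a_i/d_i$ ($2\le i\le k$) is a non-negative integer combination of $a_1/d_{i-1},\ldots,a_{i-1}/d_{i-1}$. A numerical semigroup $S$ is free if $S=\langle a_1,\ldots,a_k\rangle$ for some telescopic sequence $(a_1,\ldots,a_k)$. -}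

module Defs where

open import Data.Nat using (ℕ; zero; suc; _+_; _*_; _≤_; _<_)
open import Data.Nat.DivMod using (_/_)
open import Data.Nat.GCD using (gcd)
open import Data.Nat.Combinatorics using (_C_)
open import Data.List using (List; []; _∷_; length; map; take; lookup; foldr; removeAt)
open import Data.List.Relation.Unary.All using (All)
open import Data.List.Relation.Unary.Unique.Propositional using (Unique)
open import Data.Fin using (Fin; toℕ)
open import Data.Product using (Σ; ∃; _×_; _,_)
open import Relation.Binary.PropositionalEquality using (_≡_)
open import Relation.Nullary using (¬_)
open import Function.Bundles using (_⇔_)

T : ℕ → ℕ
T m = suc m C 2

⟨_⟩ : List ℕ → ℕ → Set
⟨ [] ⟩ x = x ≡ 0
⟨ a ∷ as ⟩ x = Σ ℕ λ c → Σ ℕ λ m → ⟨ as ⟩ m × x ≡ c * a + m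

_≐_ : (ℕ → Set) → (ℕ → Set) → Set
S ≐ S' = ∀ x → S x ⇔ S' x

record IsNumericalSemigroup (S : ℕ → Set) : Set where
  field
    zero∈ : S 0
    +-closed : ∀ x y → S x → S y → S (x + y)
    cofinite : Σ ℕ λ N → ∀ x → N ≤ x → S x

gcdL : List ℕ → ℕ
gcdL = foldr gcd 0

-- division, total (x / 0 := 0); only used with positive divisors
_div_ : ℕ → ℕ → ℕ
x div zero = 0
x div suc d = x / suc d

-- telescopic sequence (a_1,...,a_k): positive entries, gcd 1, and for
-- 2 ≤ i ≤ k, a_i/d_i ∈ ⟨ a_1/d_{i-1}, ..., a_{i-1}/d_{i-1} ⟩, d_i = gcd(a_1..a_i).
-- Here the 0-based index j = i-1 ranges over 1 ≤ j < k.
Telescopic : List ℕ → Set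
Telescopic as =
  All (λ a → 0 < a) as ×
  gcdL as ≡ 1 ×
  ((j : Fin (length as)) → 1 ≤ toℕ j →
     ⟨ map (λ a → a div gcdL (take (toℕ j) as)) (take (toℕ j) as) ⟩
       (lookup as j div gcdL (take (suc (toℕ j)) as)))

IsFree : (ℕ → Set) → Set
IsFree S = IsNumericalSemigroup S × (Σ (List ℕ) λ as → Telescopic as × (S ≐ ⟨ as ⟩))

-- G is a minimal system of generators of S: G (without repetitions) generates S
-- and no proper sub-list generates S (by monotonicity it suffices to remove
-- one element).
IsMinimalGeneratingSystem : (ℕ → Set) → List ℕ → Set
IsMinimalGeneratingSystem S G =
  Unique G × (S ≐ ⟨ G ⟩) × ((i : Fin (length G)) → ¬ (S ≐ ⟨ removeAt G i ⟩))

EmbeddingDimension : (ℕ → Set) → ℕ → Set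
EmbeddingDimension S e = Σ (List ℕ) λ G → IsMinimalGeneratingSystem S G × length G ≡ e

-- For n = 2k + 1 and n = 2k the first two triangular numbers factor as
-- T_n = d p and T_{n+1} = d q with p, q coprime, while T_{n+2} ≡ 1 (mod d)
-- is a multiple of q.  Hence ⟨T_n, T_{n+1}, T_{n+2}⟩ = d ⟨p, q⟩ + T_{n+2} ℕ is
-- a gluing, and (T_n, T_{n+1}, T_{n+2}) is telescopic.  No generator is
-- redundant: T_n is the smallest, T_{n+1} < 2 T_n (this is where n ≥ 3 is
-- needed) is not a multiple of T_n, and d divides T_n and T_{n+1} but not
-- T_{n+2}.
module Submission where

open import Defs
open import Data.Nat using (ℕ; _≤_; _+_)
open import Data.List using (_∷_; [])
open import Data.Product using (_×_)
open import Data.Nat using (zero; suc; _*_; _∸_; _<_; z≤n; s≤s; z<s; NonZero; >-nonZero)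
open import Data.Nat.Properties
open import Data.Nat.DivMod using (_/_; _%_; m≡m%n+[m/n]*n; m%n<n; n/n≡1; n/1≡n; m*n/n≡m)
open import Data.Nat.Divisibility
  using (_∣_; _∤_; divides; ∣-refl; m∣m*n; _∣0; ∣n⇒∣m*n; ∣m∣n⇒∣m+n; ∣m+n∣m⇒∣n; ∣1⇒≡1; ∣⇒≤)
open import Data.Nat.GCD using (gcd; gcd-identityʳ; gcd-assoc; c*gcd[m,n]≡gcd[cm,cn])
open import Data.Nat.Coprimality using (Coprime; coprime⇒gcd≡1)
import Data.Nat.Coprimality as Coprime
open import Data.Nat.Combinatorics using (nCk+nC[k+1]≡[n+1]C[k+1]; nC1≡n)
open import Data.Nat.Tactic.RingSolver using (solve-∀)
open import Data.List using (List; map; _++_; take; lookup; removeAt)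
open import Data.List.Relation.Unary.All as All using (All; []; _∷_)
open import Data.List.Relation.Unary.AllPairs using ([]; _∷_)
open import Data.List.Relation.Unary.Any using (here; there)
open import Data.List.Relation.Unary.Unique.Propositional using (Unique)
open import Data.List.Membership.Propositional using (_∈_)
open import Data.List.Membership.Propositional.Properties using (∈-lookup)
open import Data.Fin using (Fin; zero; suc; toℕ)
open import Data.Product using (∃₂; ∃; _,_)
open import Data.Sum using (_⊎_; inj₁; inj₂)
open import Function.Base using (_∘_)
open import Function.Bundles using (Equivalence)
open import Function.Properties.Equivalence using () renaming (refl to ⇔-refl)
open import Relation.Binary.PropositionalEquality
  using (_≡_; refl; sym; trans; cong; subst; subst₂; module ≡-Reasoning)
open import Relation.Nullary using (¬_; contradiction)

⟨⟩-zero : ∀ as → ⟨ as ⟩ 0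
⟨⟩-zero []       = refl
⟨⟩-zero (a ∷ as) = 0 , 0 , ⟨⟩-zero as , refl

⟨⟩-+-closed : ∀ as x y → ⟨ as ⟩ x → ⟨ as ⟩ y → ⟨ as ⟩ (x + y)
⟨⟩-+-closed []       _ _ refl refl = refl
⟨⟩-+-closed (a ∷ as) _ _ (c , m , m∈ , refl) (c′ , m′ , m′∈ , refl) =
  c + c′ , m + m′ , ⟨⟩-+-closed as m m′ m∈ m′∈ , regroup c c′ a m m′
  where
  regroup : ∀ c c′ a m m′ → c * a + m + (c′ * a + m′) ≡ (c + c′) * a + (m + m′)
  regroup = solve-∀

⟨⟩-++ : ∀ as {bs x y} → ⟨ as ⟩ x → ⟨ bs ⟩ y → ⟨ as ++ bs ⟩ (x + y)
⟨⟩-++ []       refl                y∈ = y∈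
⟨⟩-++ (a ∷ as) {y = y} (c , m , m∈ , refl) y∈ =
  c , m + y , ⟨⟩-++ as m∈ y∈ , +-assoc (c * a) m y

⟨⟩-*-scale : ∀ k as {x} → ⟨ as ⟩ x → ⟨ map (k *_) as ⟩ (k * x)
⟨⟩-*-scale k []       refl = *-zeroʳ k
⟨⟩-*-scale k (a ∷ as) (c , m , m∈ , refl) =
  c , k * m , ⟨⟩-*-scale k as m∈ , distribute k c a m
  where
  distribute : ∀ k c a m → k * (c * a + m) ≡ c * (k * a) + k * m
  distribute = solve-∀

multiple∈⟨⟩ : ∀ {a as} t → a ∈ as → ⟨ as ⟩ (t * a)
multiple∈⟨⟩ {as = a ∷ as} t (here refl) = t , 0 , ⟨⟩-zero as , sym (+-identityʳ (t * a))
multiple∈⟨⟩ {as = b ∷ as} t (there a∈) = 0 , _ , multiple∈⟨⟩ t a∈ , refl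

generator∈⟨⟩ : ∀ {a as} → a ∈ as → ⟨ as ⟩ a
generator∈⟨⟩ {a} a∈ = subst ⟨ _ ⟩ (*-identityˡ a) (multiple∈⟨⟩ 1 a∈)

⟨⟩-below⇒≡0 : ∀ as {x} → ⟨ as ⟩ x → All (x <_) as → x ≡ 0
⟨⟩-below⇒≡0 []       x≡0                   []         = x≡0
⟨⟩-below⇒≡0 (a ∷ as) (zero  , m , m∈ , refl) (_ ∷ m<as) = ⟨⟩-below⇒≡0 as m∈ m<as
⟨⟩-below⇒≡0 (a ∷ as) (suc c , m , _  , refl) (x<a ∷ _)  =
  contradiction (≤-trans (m≤m+n a (c * a)) (m≤m+n _ m)) (<⇒≱ x<a)

⟨∷⟩-below⇒∣ : ∀ {a} as {x} → ⟨ a ∷ as ⟩ x → All (x <_) as → a ∣ x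
⟨∷⟩-below⇒∣ {a} as (c , m , m∈ , refl) x<as =
  divides c (trans (cong (c * a +_) m≡0) (+-identityʳ (c * a)))
  where
  m≡0 : m ≡ 0
  m≡0 = ⟨⟩-below⇒≡0 as m∈ (All.map (≤-<-trans (m≤n+m m (c * a))) x<as)

⟨⟩-∣ : ∀ {d} as {x} → All (d ∣_) as → ⟨ as ⟩ x → d ∣ x
⟨⟩-∣ {d} []       []            refl                = d ∣0
⟨⟩-∣     (a ∷ as) (d∣a ∷ d∣as) (c , m , m∈ , refl) =
  ∣m∣n⇒∣m+n (∣n⇒∣m*n c d∣a) (⟨⟩-∣ as d∣as m∈)

independent⇒minimal : ∀ {as} → Unique as → (∀ i → ¬ ⟨ removeAt as i ⟩ (lookup as i)) →
                      IsMinimalGeneratingSystem ⟨ as ⟩ as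
independent⇒minimal unique independent =
  unique , (λ _ → ⇔-refl) ,
  λ i same → independent i (Equivalence.to (same _) (generator∈⟨⟩ (∈-lookup i)))

m<n<m+m⇒m∤n : ∀ {m n} → m < n → n < m + m → m ∤ n
m<n<m+m⇒m∤n m<n _ (divides zero          refl) = n≮0 m<n
m<n<m+m⇒m∤n m<n _ (divides (suc zero)    refl) = <-irrefl (sym (+-identityʳ _)) m<n
m<n<m+m⇒m∤n {m} _ n<m+m (divides (suc (suc k)) refl) =
  <⇒≱ n<m+m (+-monoʳ-≤ m (m≤m+n m (k * m)))

minimal₃ : ∀ {d a b c} → 0 < a → a < b → b < c → b < a + a → d ∣ a → d ∣ b → d ∤ c →
           IsMinimalGeneratingSystem ⟨ a ∷ b ∷ c ∷ [] ⟩ (a ∷ b ∷ c ∷ [])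
minimal₃ {_} {a} {b} {c} 0<a a<b b<c b<a+a d∣a d∣b d∤c = independent⇒minimal unique independent
  where
  unique : Unique (a ∷ b ∷ c ∷ [])
  unique = (<⇒≢ a<b ∷ <⇒≢ (<-trans a<b b<c) ∷ []) ∷ (<⇒≢ b<c ∷ []) ∷ [] ∷ []
  independent : ∀ i → ¬ ⟨ removeAt (a ∷ b ∷ c ∷ []) i ⟩ (lookup (a ∷ b ∷ c ∷ []) i)
  independent zero a∈ =
    <⇒≱ a<b (∣⇒≤ {{>-nonZero 0<a}} (⟨∷⟩-below⇒∣ (c ∷ []) a∈ (<-trans a<b b<c ∷ [])))
  independent (suc zero) b∈ = m<n<m+m⇒m∤n a<b b<a+a (⟨∷⟩-below⇒∣ (c ∷ []) b∈ (b<c ∷ []))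
  independent (suc (suc zero)) c∈ = d∤c (⟨⟩-∣ (a ∷ b ∷ []) (d∣a ∷ d∣b ∷ []) c∈)

bézout⇒coprime : ∀ {m n} w r → w * m ≡ r * n + 1 → Coprime m n
bézout⇒coprime w r eq {e} (e∣m , e∣n) =
  ∣1⇒≡1 (∣m+n∣m⇒∣n (subst (e ∣_) eq (∣n⇒∣m*n w e∣m)) (∣n⇒∣m*n r e∣n))

m*n-div-m≡n : ∀ m n .{{_ : NonZero m}} → (m * n) div m ≡ n
m*n-div-m≡n (suc m) n = trans (cong (_/ suc m) (*-comm (suc m) n)) (m*n/n≡m n (suc m))

n-div-n≡1 : ∀ {n} → 0 < n → n div n ≡ 1
n-div-n≡1 {suc n} _ = n/n≡1 (suc n)

gcd[dp,dq]≡d : ∀ d {p q} → Coprime p q → gcd (d * p) (d * q) ≡ d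
gcd[dp,dq]≡d d {p} {q} p⊥q = begin
  gcd (d * p) (d * q) ≡⟨ c*gcd[m,n]≡gcd[cm,cn] d p q ⟨
  d * gcd p q         ≡⟨ cong (d *_) (coprime⇒gcd≡1 p⊥q) ⟩
  d * 1               ≡⟨ *-identityʳ d ⟩
  d                   ∎
  where open ≡-Reasoning

telescopic₃ : ∀ {d p q c} .{{_ : NonZero d}} → All (0 <_) (d * p ∷ d * q ∷ c ∷ []) →
              Coprime p q → Coprime d c → ⟨ p ∷ q ∷ [] ⟩ c → Telescopic (d * p ∷ d * q ∷ c ∷ [])
telescopic₃ {d} {p} {q} {c} positive@(0<a ∷ _) p⊥q d⊥c c∈ = positive , gcd₃≡1 , condition
  where
  gcd₂≡d : gcdL (d * p ∷ d * q ∷ []) ≡ d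
  gcd₂≡d = trans (cong (gcd (d * p)) (gcd-identityʳ (d * q))) (gcd[dp,dq]≡d d p⊥q)

  gcd₃≡1 : gcdL (d * p ∷ d * q ∷ c ∷ []) ≡ 1
  gcd₃≡1 = begin
    gcd (d * p) (gcd (d * q) (gcd c 0)) ≡⟨ cong (gcd (d * p) ∘ gcd (d * q)) (gcd-identityʳ c) ⟩
    gcd (d * p) (gcd (d * q) c)         ≡⟨ gcd-assoc (d * p) (d * q) c ⟨
    gcd (gcd (d * p) (d * q)) c         ≡⟨ cong (λ g → gcd g c) (gcd[dp,dq]≡d d p⊥q) ⟩
    gcd d c                             ≡⟨ coprime⇒gcd≡1 d⊥c ⟩
    1                                   ∎
    where open ≡-Reasoning

  gens : List ℕ
  gens = d * p ∷ d * q ∷ c ∷ []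

  condition : (j : Fin 3) → 1 ≤ toℕ j →
    ⟨ map (_div gcdL (take (toℕ j) gens)) (take (toℕ j) gens) ⟩
      (lookup gens j div gcdL (take (suc (toℕ j)) gens))
  condition (suc zero) _ =
    subst (λ g → ⟨ g ∷ [] ⟩ b′) (sym a-div-a≡1)
      (subst ⟨ 1 ∷ [] ⟩ (*-identityʳ b′) (multiple∈⟨⟩ b′ (here refl)))
    where
    b′ : ℕ
    b′ = (d * q) div gcdL (d * p ∷ d * q ∷ [])
    a-div-a≡1 : (d * p) div gcdL (d * p ∷ []) ≡ 1
    a-div-a≡1 = trans (cong ((d * p) div_) (gcd-identityʳ (d * p))) (n-div-n≡1 0<a)
  condition (suc (suc zero)) _ =
    subst ⟨ _ ⟩ (sym (trans (cong (c div_) gcd₃≡1) (n/1≡n c)))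
      (subst₂ (λ x y → ⟨ x ∷ y ∷ [] ⟩ c) (sym (quotient p)) (sym (quotient q)) c∈)
    where
    quotient : ∀ x → (d * x) div gcdL (d * p ∷ d * q ∷ []) ≡ x
    quotient x = trans (cong ((d * x) div_) gcd₂≡d) (m*n-div-m≡n d x)

-- With r = x mod d, the r w copies of e contribute r (s d + 1) ≡ r (mod d), and
-- the excess r s d ≤ d s d is absorbed by the quotient of x by d.
split-large : ∀ d e w s M x .{{_ : NonZero d}} → w * e ≡ s * d + 1 → (M + d * s) * d ≤ x →
              ∃₂ λ y t → M ≤ y × x ≡ y * d + t * e
split-large d e w s M x w*e≡ M+ds≤x = M + o , r * w , m≤m+n M o , (begin
  x                             ≡⟨ m≡m%n+[m/n]*n x d ⟩
  r + Q * d                     ≡⟨ cong (λ z → r + z * d) (m+[n∸m]≡n M+rs≤Q) ⟨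
  r + (M + r * s + o) * d       ≡⟨ regroup r M s o d ⟩
  (M + o) * d + r * (s * d + 1) ≡⟨ cong (λ z → (M + o) * d + r * z) w*e≡ ⟨
  (M + o) * d + r * (w * e)     ≡⟨ cong ((M + o) * d +_) (*-assoc r w e) ⟨
  (M + o) * d + r * w * e       ∎)
  where
  open ≡-Reasoning

  r Q o : ℕ
  r = x % d
  Q = x / d
  o = Q ∸ (M + r * s)

  x<[1+Q]*d : x < suc Q * d
  x<[1+Q]*d = subst (_< suc Q * d) (sym (m≡m%n+[m/n]*n x d)) (+-monoˡ-< (Q * d) (m%n<n x d))

  M+rs≤Q : M + r * s ≤ Q
  M+rs≤Q = ≤-trans (+-monoʳ-≤ M (*-monoˡ-≤ s (<⇒≤ (m%n<n x d))))
                   (≤-pred (*-cancelʳ-< d (M + d * s) (suc Q) (≤-<-trans M+ds≤x x<[1+Q]*d)))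

  regroup : ∀ r M s o d → r + (M + r * s + o) * d ≡ (M + o) * d + r * (s * d + 1)
  regroup = solve-∀

bézout⇒⟨⟩₂-cofinite : ∀ {p q} w r .{{_ : NonZero p}} → w * q ≡ r * p + 1 →
                      ∀ y → p * r * p ≤ y → ⟨ p ∷ q ∷ [] ⟩ y
bézout⇒⟨⟩₂-cofinite {p} {q} w r bézout y p*r*p≤y with split-large p q w r 0 y bézout p*r*p≤y
... | y′ , t , _ , y≡ = y′ , t * q + 0 , (t , 0 , refl , refl) ,
                        trans y≡ (cong (y′ * p +_) (sym (+-identityʳ (t * q))))

glued-cofinite : ∀ {d p q c} w r s .{{_ : NonZero d}} .{{_ : NonZero p}} →
                 w * q ≡ r * p + 1 → c ≡ s * d + 1 →
                 ∀ x → (p * r * p + d * s) * d ≤ x → ⟨ d * p ∷ d * q ∷ c ∷ [] ⟩ x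
glued-cofinite {d} {p} {q} {c} w r s bézout c≡ x large
  with split-large d c 1 s (p * r * p) x (trans (*-identityˡ c) c≡) large
... | y , t , y-large , x≡ =
  subst ⟨ d * p ∷ d * q ∷ c ∷ [] ⟩ (sym (trans x≡ (cong (_+ t * c) (*-comm y d))))
    (⟨⟩-++ (d * p ∷ d * q ∷ [])
      (⟨⟩-*-scale d (p ∷ q ∷ []) (bézout⇒⟨⟩₂-cofinite w r bézout y y-large))
      (multiple∈⟨⟩ t (here refl)))

-- ⟨ a, b, c ⟩ = d ⟨ p, q ⟩ + c ℕ, where w is an inverse of q modulo p and c ≡ 1 (mod d).
record GluingData (a b c : ℕ) : Set where
  constructor gluing
  field
    d p q w r s : ℕ
    a≡d*p       : a ≡ d * p
    b≡d*q       : b ≡ d * q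
    bézout      : w * q ≡ r * p + 1
    c≡s*d+1     : c ≡ s * d + 1
    c∈⟨p,q⟩     : ⟨ p ∷ q ∷ [] ⟩ c
    1<d         : 1 < d

n<m+m⇒0<m : ∀ {m n} → n < m + m → 0 < m
n<m+m⇒0<m {suc m} _ = z<s

glued-free∧embeddingDimension3 : ∀ {a b c} → a < b → b < c → b < a + a → GluingData a b c →
  IsFree ⟨ a ∷ b ∷ c ∷ [] ⟩ × EmbeddingDimension ⟨ a ∷ b ∷ c ∷ [] ⟩ 3
glued-free∧embeddingDimension3 {c = c} a<b b<c b<a+a
  (gluing d p q w r s refl refl bézout c≡s*d+1 c∈⟨p,q⟩ 1<d) =
  (semigroup , gens , telescopic , λ _ → ⇔-refl) , gens , minimal , refl
  where
  gens : List ℕ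
  gens = d * p ∷ d * q ∷ c ∷ []

  0<a : 0 < d * p
  0<a = n<m+m⇒0<m b<a+a

  instance
    d≢0 : NonZero d
    d≢0 = >-nonZero (<-trans z<s 1<d)
    p≢0 : NonZero p
    p≢0 = m*n≢0⇒n≢0 d {{>-nonZero 0<a}}

  d⊥c : Coprime d c
  d⊥c = Coprime.sym (bézout⇒coprime 1 s (trans (*-identityˡ c) c≡s*d+1))

  d∤c : d ∤ c
  d∤c d∣c = <⇒≢ 1<d (sym (d⊥c (∣-refl , d∣c)))

  semigroup : IsNumericalSemigroup ⟨ gens ⟩
  semigroup = record
    { zero∈    = ⟨⟩-zero gens
    ; +-closed = ⟨⟩-+-closed gens
    ; cofinite = (p * r * p + d * s) * d , glued-cofinite w r s bézout c≡s*d+1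
    }

  telescopic : Telescopic gens
  telescopic = telescopic₃ (0<a ∷ <-trans 0<a a<b ∷ <-trans 0<a (<-trans a<b b<c) ∷ [])
                           (Coprime.sym (bézout⇒coprime w r bézout)) d⊥c c∈⟨p,q⟩

  minimal : IsMinimalGeneratingSystem ⟨ gens ⟩ gens
  minimal = minimal₃ 0<a a<b b<c b<a+a (m∣m*n p) (m∣m*n q) d∤c

T-suc : ∀ m → T (suc m) ≡ suc m + T m
T-suc m = trans (sym (nCk+nC[k+1]≡[n+1]C[k+1] (suc m) 1)) (cong (_+ T m) (nC1≡n (suc m)))

T*2≡m*[1+m] : ∀ m → T m * 2 ≡ m * suc m
T*2≡m*[1+m] zero    = refl
T*2≡m*[1+m] (suc m) = begin
  T (suc m) * 2             ≡⟨ cong (_* 2) (T-suc m) ⟩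
  (suc m + T m) * 2         ≡⟨ *-distribʳ-+ 2 (suc m) (T m) ⟩
  suc m * 2 + T m * 2       ≡⟨ cong (suc m * 2 +_) (T*2≡m*[1+m] m) ⟩
  suc m * 2 + m * suc m     ≡⟨ pascal m ⟩
  suc m * suc (suc m)       ∎
  where
  open ≡-Reasoning

  pascal : ∀ m → (1 + m) * 2 + m * (1 + m) ≡ (1 + m) * (2 + m)
  pascal = solve-∀

m*[1+m]≡t*2⇒T≡t : ∀ m t → m * suc m ≡ t * 2 → T m ≡ t
m*[1+m]≡t*2⇒T≡t m t eq = *-cancelʳ-≡ (T m) t 2 (trans (T*2≡m*[1+m] m) eq)

T[n]<T[n+1] : ∀ n → T n < T (n + 1)
T[n]<T[n+1] n = subst (λ k → T n < T k) (+-comm 1 n)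
                  (subst (T n <_) (sym (T-suc n)) (m<n+m (T n) z<s))

T[n+1]<T[n+2] : ∀ n → T (n + 1) < T (n + 2)
T[n+1]<T[n+2] n = subst (λ k → T (n + 1) < T k) (+-assoc n 1 1) (T[n]<T[n+1] (n + 1))

T[n+1]<T[n]+T[n] : ∀ {n} → 3 ≤ n → T (n + 1) < T n + T n
T[n+1]<T[n]+T[n] {n} 3≤n = subst (_< T n + T n) (sym T[n+1]≡) (+-monoˡ-< (T n) 1+n<T[n])
  where
  T[n+1]≡ : T (n + 1) ≡ suc n + T n
  T[n+1]≡ = trans (cong T (+-comm n 1)) (T-suc n)

  1+n<T[n] : suc n < T n
  1+n<T[n] = *-cancelʳ-< 2 (suc n) (T n) (begin-strict
    suc n * 2 <⟨ *-monoʳ-< (suc n) (n<1+n 2) ⟩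
    suc n * 3 ≤⟨ *-monoʳ-≤ (suc n) 3≤n ⟩
    suc n * n ≡⟨ *-comm (suc n) n ⟩
    n * suc n ≡⟨ T*2≡m*[1+m] n ⟨
    T n * 2   ∎)
    where open ≤-Reasoning

even⊎odd : ∀ m → (∃ λ j → m ≡ j * 2) ⊎ (∃ λ j → m ≡ suc (j * 2))
even⊎odd zero = inj₁ (0 , refl)
even⊎odd (suc m) with even⊎odd m
... | inj₁ (j , refl) = inj₂ (j , refl)
... | inj₂ (j , refl) = inj₁ (suc j , refl)

-- n = 2k + 1, k = j + 1:  T_n = (k + 1)(2k + 1),  T_{n+1} = (k + 1)(2k + 3),  T_{n+2} = (k + 2)(2k + 3).
T-gluing-odd : ∀ j → let n = 3 + j * 2 in GluingData (T n) (T (n + 1)) (T (n + 2))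
T-gluing-odd j = gluing (2 + j) (3 + j * 2) (5 + j * 2) (2 + j) (3 + j) (7 + j * 2)
  (m*[1+m]≡t*2⇒T≡t n _ (a≡ j))
  (m*[1+m]≡t*2⇒T≡t (n + 1) _ (b≡ j))
  (bézout j)
  (m*[1+m]≡t*2⇒T≡t (n + 2) _ (c≡ j))
  (subst ⟨ _ ⟩ (sym (m*[1+m]≡t*2⇒T≡t (n + 2) _ (c≡multiple j))) (multiple∈⟨⟩ (3 + j) (there (here refl))))
  (s≤s (s≤s z≤n))
  where
  n : ℕ
  n = 3 + j * 2

  a≡ : ∀ j → (3 + j * 2) * suc (3 + j * 2) ≡ (2 + j) * (3 + j * 2) * 2
  a≡ = solve-∀
  b≡ : ∀ j → (3 + j * 2 + 1) * suc (3 + j * 2 + 1) ≡ (2 + j) * (5 + j * 2) * 2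
  b≡ = solve-∀
  c≡ : ∀ j → (3 + j * 2 + 2) * suc (3 + j * 2 + 2) ≡ ((7 + j * 2) * (2 + j) + 1) * 2
  c≡ = solve-∀
  c≡multiple : ∀ j → (3 + j * 2 + 2) * suc (3 + j * 2 + 2) ≡ (3 + j) * (5 + j * 2) * 2
  c≡multiple = solve-∀
  bézout : ∀ j → (2 + j) * (5 + j * 2) ≡ (3 + j) * (3 + j * 2) + 1
  bézout = solve-∀

-- n = 2k, k = j + 2:  T_n = (2k + 1) k,  T_{n+1} = (2k + 1)(k + 1),  T_{n+2} = (2k + 3)(k + 1).
T-gluing-even : ∀ j → let n = 4 + j * 2 in GluingData (T n) (T (n + 1)) (T (n + 2))
T-gluing-even j = gluing (5 + j * 2) (2 + j) (3 + j) 1 1 (4 + j)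
  (m*[1+m]≡t*2⇒T≡t n _ (a≡ j))
  (m*[1+m]≡t*2⇒T≡t (n + 1) _ (b≡ j))
  (bézout j)
  (m*[1+m]≡t*2⇒T≡t (n + 2) _ (c≡ j))
  (subst ⟨ _ ⟩ (sym (m*[1+m]≡t*2⇒T≡t (n + 2) _ (c≡multiple j))) (multiple∈⟨⟩ (7 + j * 2) (there (here refl))))
  (s≤s (s≤s z≤n))
  where
  n : ℕ
  n = 4 + j * 2

  a≡ : ∀ j → (4 + j * 2) * suc (4 + j * 2) ≡ (5 + j * 2) * (2 + j) * 2
  a≡ = solve-∀
  b≡ : ∀ j → (4 + j * 2 + 1) * suc (4 + j * 2 + 1) ≡ (5 + j * 2) * (3 + j) * 2
  b≡ = solve-∀
  c≡ : ∀ j → (4 + j * 2 + 2) * suc (4 + j * 2 + 2) ≡ ((4 + j) * (5 + j * 2) + 1) * 2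
  c≡ = solve-∀
  c≡multiple : ∀ j → (4 + j * 2 + 2) * suc (4 + j * 2 + 2) ≡ (7 + j * 2) * (3 + j) * 2
  c≡multiple = solve-∀
  bézout : ∀ j → 1 * (3 + j) ≡ 1 * (2 + j) + 1
  bézout = solve-∀

T-gluing : ∀ {n} → 3 ≤ n → GluingData (T n) (T (n + 1)) (T (n + 2))
T-gluing {suc (suc (suc m))} (s≤s (s≤s (s≤s z≤n))) with even⊎odd m
... | inj₁ (j , refl) = T-gluing-odd j
... | inj₂ (j , refl) = T-gluing-even j

proposition24 : (n : ℕ) → 3 ≤ n →
    IsFree ⟨ T n ∷ T (n + 1) ∷ T (n + 2) ∷ [] ⟩ ×
    EmbeddingDimension ⟨ T n ∷ T (n + 1) ∷ T (n + 2) ∷ [] ⟩ 3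
proposition24 n 3≤n = glued-free∧embeddingDimension3
  (T[n]<T[n+1] n) (T[n+1]<T[n+2] n) (T[n+1]<T[n]+T[n] 3≤n) (T-gluing 3≤n)
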